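{- Let $q$ be an odd prime power and let $\gamma,\delta\in\mathbb{F}_{q^2}$ with $\gamma\neq 0$. Then the polynomial $$f(x)=(x^q-x+\delta)^{q+2}+(x^q-x+\delta)^{2q+1}+\gamma x$$ is a permutation polynomial of $\mathbb{F}_{q^2}$ if and only if either $\gamma\in\mathbb{F}_q^*$, or $\gamma\in\mathbb{F}_{q^2}^*\setminus\mathbb{F}_q$ and $\mathrm{Tr}_q^{q^2}(\delta)=0$.
   Context: A polynomial over a finite field $\mathbb{F}$ is a permutation polynomial of $\mathbb{F}$ if the map it induces on $\mathbb{F}$ is a bijection. For $x\in\mathbb{F}_{q^2}$, $\mathrm{Tr}_q^{q^2}(x)=x+x^q$. -}

module Defs where

open import Level using (Level; _⊔_)
open import Data.Nat.Divisibility using (_∣_)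
open import Data.Nat using (ℕ; _≤_) renaming (_*_ to _*ℕ_; _^_ to _^ℕ_)
open import Data.Nat.Primality using (Prime)
open import Data.Fin using (Fin)
open import Data.Product using (∃; ∃₂; _×_)
open import Relation.Nullary using (¬_)
open import Relation.Binary.PropositionalEquality using (_≡_)
import Relation.Binary.PropositionalEquality as ≡
open import Function.Bundles using (Inverse)
open import Function.Definitions using (Bijective)
open import Algebra.Bundles using (CommutativeRing)
import Algebra.Bundles
import Algebra.Definitions.RawSemiring as RS

IsOddPrimePower : ℕ → Set
IsOddPrimePower q = ∃₂ λ p k → Prime p × ¬ (2 ∣ p) × 1 ≤ k × q ≡ p ^ℕ k

record IsFiniteFieldOfSize {c ℓ : Level} (F : CommutativeRing c ℓ) (n : ℕ) : Set (c ⊔ ℓ) where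
  open CommutativeRing F
  field
    nontrivial : ¬ (1# ≈ 0#)
    inverses   : ∀ x → ¬ (x ≈ 0#) → ∃ λ y → x * y ≈ 1#
    enumeration : Inverse (≡.setoid (Fin n)) setoid

module FieldOps {c ℓ : Level} (F : CommutativeRing c ℓ) where
  open CommutativeRing F public
  open RS (Algebra.Bundles.Semiring.rawSemiring semiring) public using (_^_)

  infixl 6 _−_
  _−_ : Carrier → Carrier → Carrier
  x − y = x + (- y)

  -- x ∈ F_q inside F_{q^2}: the subfield of order q is {x | x^q = x}.
  InSubfield : ℕ → Carrier → Set ℓ
  InSubfield q x = x ^ q ≈ x

  Tr : ℕ → Carrier → Carrier
  Tr q x = x + x ^ q

  IsPermutation : (Carrier → Carrier) → Set (c ⊔ ℓ)
  IsPermutation f = Bijective _≈_ _≈_ f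

{-# OPTIONS --safe #-}
-- Write σ x = x ^ q, an involutive automorphism of F_{q²} fixing F_q (additive because p divides
-- the inner binomial coefficients of (x + y) ^ p; involutive because x ^ (q²) = x), Δ x = σ x − x and
-- w = Δ x + δ. Since Δ x is skew (σ (Δ x) = − Δ x), Tr w = Tr δ, and
--   w ^ (q + 2) + w ^ (2q + 1) = w σ w (w + σ w) = N(w) Tr(δ),
-- so f x = N(Δ x + δ) Tr(δ) + γ x with N(w) ∈ F_q.  If Tr(δ) = 0 then f x = γ x.  If γ ∈ F_q,
-- applying σ to f x = f z and subtracting gives γ Δ x = γ Δ z, so the norm terms agree and x = z.
-- Otherwise put t = γ⁻¹ and s = Δ t ≠ 0; then
--   f (x + t) − f x = s Tr(δ) (Δ w − s) + 1,
-- and since Δ maps F_{q²} onto the skew elements (σ γ ≠ γ), x can be chosen with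
-- Δ w = s − (s Tr δ)⁻¹, giving f (x + t) = f x.  Injective maps of a finite set are bijective.
module Submission where

open import Defs
open import Level using (Level)
open import Data.Nat using (ℕ) renaming (_*_ to _*ℕ_; _+_ to _+ℕ_)
open import Data.Product using (_×_)
open import Data.Sum using (_⊎_)
open import Relation.Nullary using (¬_)
open import Function.Bundles using (_⇔_)
open import Algebra.Bundles using (CommutativeRing)

open import Data.Nat as ℕ using (zero; suc; _∸_)
import Data.Nat.Properties as ℕ
open import Data.Nat.Combinatorics using (_C_; nCn≡1; nC1≡n; nCk+nC[k+1]≡[n+1]C[k+1])
open import Data.Nat.Divisibility using (_∣_; divides; ∣⇒≤; m%n≡0⇒n∣m)
open import Data.Nat.DivMod using (_%_; _/_; m%n<n; m≡m%n+[m/n]*n)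
open import Data.Nat.Primality using (Prime; euclidsLemma)
open import Data.Integer as ℤ using (ℤ; +_; -[1+_]; _⊖_)
import Data.Integer.Properties as ℤ
open import Data.Sign as Sign using (Sign)
open import Data.Fin as Fin using (Fin; punchIn)
import Data.Fin.Properties as Fin
open import Data.Fin.Permutation using (Permutation′; permutation; _⟨$⟩ʳ_; remove; insert; insert-remove; insert-punchIn)
import Algebra.Properties.CommutativeMonoid.Sum as CommutativeMonoidSum
open import Data.Maybe using (Maybe; just; nothing)
open import Data.Product using (∃; ∃₂; _,_; proj₁; proj₂)
open import Data.Sum using (inj₁; inj₂)
open import Data.Empty using (⊥; ⊥-elim)
open import Relation.Nullary using (Dec; yes; no; contradiction)
import Relation.Nullary.Decidable as Dec
open import Relation.Binary.Definitions using (Decidable)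
open import Relation.Binary.PropositionalEquality as ≡ using (_≡_; _≢_)
open import Function.Base using (_∘_)
open import Function.Bundles using (Inverse; mk⇔)
open import Function.Definitions using (Injective; Surjective)

module IntegerCoefficientSolver {c ℓ} (R : CommutativeRing c ℓ) where
  open CommutativeRing R
  open import Algebra.Properties.Ring ring using (-0#≈0#; -‿involutive; -‿+-comm; -‿distribˡ-*; -‿distribʳ-*)
  open import Algebra.Properties.CommutativeSemigroup +-commutativeSemigroup using (interchange)
  open import Algebra.Properties.Semiring.Mult.TCOptimised semiring using (1+×; ×-homo-+; ×1-homo-*) renaming (_×_ to _×′_)
  open import Algebra.Solver.Ring.AlmostCommutativeRing using (fromCommutativeRing; _-Raw-AlmostCommutative⟶_)
  open import Relation.Binary.Reasoning.Setoid setoid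

  private
    -- The optimised multiplication makes ⟦ + 1 ⟧ reduce to 1#, so that con (+ 1) can stand for 1#.
    ι : ℕ → Carrier
    ι n = n ×′ 1#

    signed : Sign → Carrier → Carrier
    signed Sign.+ x = x
    signed Sign.- x = - x

    ⟦_⟧ : ℤ → Carrier
    ⟦ i ⟧ = signed (ℤ.sign i) (ι ℤ.∣ i ∣)

    signed-cong : ∀ s {x y} → x ≈ y → signed s x ≈ signed s y
    signed-cong Sign.+ x≈y = x≈y
    signed-cong Sign.- x≈y = -‿cong x≈y

    signed-* : ∀ s t x y → signed (s Sign.* t) (x * y) ≈ signed s x * signed t y
    signed-* Sign.+ Sign.+ x y = refl
    signed-* Sign.+ Sign.- x y = -‿distribʳ-* x y
    signed-* Sign.- Sign.+ x y = -‿distribˡ-* x y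
    signed-* Sign.- Sign.- x y = begin
      x * y         ≈⟨ -‿involutive (x * y) ⟨
      - - (x * y)   ≈⟨ -‿cong (-‿distribˡ-* x y) ⟩
      - (- x * y)   ≈⟨ -‿distribʳ-* (- x) y ⟩
      - x * - y     ∎

    ◃-homo : ∀ s n → ⟦ s ℤ.◃ n ⟧ ≈ signed s (ι n)
    ◃-homo Sign.+ zero    = refl
    ◃-homo Sign.- zero    = sym -0#≈0#
    ◃-homo Sign.+ (suc n) = refl
    ◃-homo Sign.- (suc n) = refl

    ⊖-homo : ∀ m n → ⟦ m ⊖ n ⟧ ≈ ι m - ι n
    ⊖-homo m       zero    = trans (sym (+-identityʳ (ι m))) (+-congˡ (sym -0#≈0#))
    ⊖-homo zero    (suc n) = sym (+-identityˡ _)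
    ⊖-homo (suc m) (suc n) = begin
      ⟦ suc m ⊖ suc n ⟧          ≡⟨ ≡.cong ⟦_⟧ (ℤ.[1+m]⊖[1+n]≡m⊖n m n) ⟩
      ⟦ m ⊖ n ⟧                  ≈⟨ ⊖-homo m n ⟩
      ι m - ι n                  ≈⟨ +-identityˡ _ ⟨
      0# + (ι m - ι n)           ≈⟨ +-congʳ (-‿inverseʳ 1#) ⟨
      (1# - 1#) + (ι m - ι n)    ≈⟨ interchange 1# (- 1#) (ι m) (- ι n) ⟩
      (1# + ι m) + (- 1# - ι n)  ≈⟨ +-cong (1+× m 1#) (trans (-‿cong (1+× n 1#)) (sym (-‿+-comm 1# (ι n)))) ⟨
      ι (suc m) - ι (suc n)      ∎

    +-homo : ∀ i j → ⟦ i ℤ.+ j ⟧ ≈ ⟦ i ⟧ + ⟦ j ⟧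
    +-homo (+ m)    (+ n)    = ×-homo-+ 1# m n
    +-homo (+ m)    -[1+ n ] = ⊖-homo m (suc n)
    +-homo -[1+ m ] (+ n)    = trans (⊖-homo n (suc m)) (+-comm _ _)
    +-homo -[1+ m ] -[1+ n ] = begin
      - ι (suc (suc (m ℕ.+ n)))  ≡⟨ ≡.cong (λ k → - ι (suc k)) (ℕ.+-suc m n) ⟨
      - ι (suc m ℕ.+ suc n)      ≈⟨ -‿cong (×-homo-+ 1# (suc m) (suc n)) ⟩
      - (ι (suc m) + ι (suc n))  ≈⟨ -‿+-comm _ _ ⟨
      - ι (suc m) - ι (suc n)    ∎

    *-homo : ∀ i j → ⟦ i ℤ.* j ⟧ ≈ ⟦ i ⟧ * ⟦ j ⟧
    *-homo i j = begin
      ⟦ s ℤ.◃ ℤ.∣ i ∣ ℕ.* ℤ.∣ j ∣ ⟧        ≈⟨ ◃-homo s (ℤ.∣ i ∣ ℕ.* ℤ.∣ j ∣) ⟩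
      signed s (ι (ℤ.∣ i ∣ ℕ.* ℤ.∣ j ∣))  ≈⟨ signed-cong s (×1-homo-* ℤ.∣ i ∣ ℤ.∣ j ∣) ⟩
      signed s (ι ℤ.∣ i ∣ * ι ℤ.∣ j ∣)     ≈⟨ signed-* (ℤ.sign i) (ℤ.sign j) _ _ ⟩
      ⟦ i ⟧ * ⟦ j ⟧                       ∎
      where s = ℤ.sign i Sign.* ℤ.sign j

    -‿homo : ∀ i → ⟦ ℤ.- i ⟧ ≈ - ⟦ i ⟧
    -‿homo -[1+ n ]  = sym (-‿involutive _)
    -‿homo (+ zero)  = sym -0#≈0#
    -‿homo (+ suc n) = refl

    homomorphism : CommutativeRing.rawRing ℤ.+-*-commutativeRing -Raw-AlmostCommutative⟶ fromCommutativeRing R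
    homomorphism = record
      { ⟦_⟧ = ⟦_⟧ ; +-homo = +-homo ; *-homo = *-homo ; -‿homo = -‿homo
      ; 0-homo = refl ; 1-homo = refl
      }

    _≟ℤ_ : ∀ i j → Maybe (⟦ i ⟧ ≈ ⟦ j ⟧)
    i ≟ℤ j with i ℤ.≟ j
    ... | yes ≡.refl = just refl
    ... | no _       = nothing

  open import Algebra.Solver.Ring (CommutativeRing.rawRing ℤ.+-*-commutativeRing) (fromCommutativeRing R) homomorphism _≟ℤ_ public
    using (solve; _:+_; _:*_; :-_; _:-_; _:=_; con)

[1+k]*[1+n]C[1+k]≡[1+n]*nCk : ∀ n k → suc k ℕ.* (suc n C suc k) ≡ suc n ℕ.* (n C k)
[1+k]*[1+n]C[1+k]≡[1+n]*nCk zero    zero    = ≡.refl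
[1+k]*[1+n]C[1+k]≡[1+n]*nCk zero    (suc k) = ℕ.*-zeroʳ (suc (suc k))
[1+k]*[1+n]C[1+k]≡[1+n]*nCk (suc n) zero    =
  ≡.trans (ℕ.*-identityˡ _) (≡.trans (nC1≡n (suc (suc n))) (≡.sym (ℕ.*-identityʳ (suc (suc n)))))
[1+k]*[1+n]C[1+k]≡[1+n]*nCk (suc n) (suc k) = begin
  (2 + k) * ((2 + n) C (2 + k))               ≡⟨ ≡.cong ((2 + k) *_) (nCk+nC[k+1]≡[n+1]C[k+1] (suc n) (suc k)) ⟨
  (2 + k) * (a + b)                           ≡⟨ solve 3 (λ k a b → (con 2 :+ k) :* (a :+ b)
                                                              := a :+ ((con 1 :+ k) :* a :+ (con 2 :+ k) :* b)) ≡.refl k a b ⟩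
  a + ((1 + k) * a + (2 + k) * b)             ≡⟨ ≡.cong₂ (λ u v → a + (u + v)) ([1+k]*[1+n]C[1+k]≡[1+n]*nCk n k) ([1+k]*[1+n]C[1+k]≡[1+n]*nCk n (suc k)) ⟩
  a + ((1 + n) * (n C k) + (1 + n) * (n C suc k)) ≡⟨ ≡.cong (λ u → a + u) (ℕ.*-distribˡ-+ (1 + n) (n C k) (n C suc k)) ⟨
  a + (1 + n) * (n C k + n C suc k)           ≡⟨ ≡.cong (λ u → a + (1 + n) * u) (nCk+nC[k+1]≡[n+1]C[k+1] n k) ⟩
  a + (1 + n) * a                             ≡⟨ solve 2 (λ n a → a :+ (con 1 :+ n) :* a := (con 2 :+ n) :* a) ≡.refl n a ⟩
  (2 + n) * a                                 ∎
  where
  open import Data.Nat using (_+_; _*_)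
  open ≡.≡-Reasoning
  open import Data.Nat.Solver using (module +-*-Solver)
  open +-*-Solver
  a b : ℕ
  a = suc n C suc k
  b = suc n C suc (suc k)

p∣pCk : ∀ {p} k → Prime p → 0 ℕ.< k → k ℕ.< p → p ∣ p C k
p∣pCk {suc n} (suc j) p-prime _ k<p
  with euclidsLemma (suc j) (suc n C suc j) p-prime
         (divides (n C j) (≡.trans ([1+k]*[1+n]C[1+k]≡[1+n]*nCk n j) (ℕ.*-comm (suc n) (n C j))))
... | inj₁ p∣k    = contradiction (∣⇒≤ p∣k) (ℕ.<⇒≱ k<p)
... | inj₂ p∣pCk′ = p∣pCk′

¬2∣n⇒n≡1+[n/2]*2 : ∀ n → ¬ 2 ∣ n → n ≡ 1 ℕ.+ (n / 2) ℕ.* 2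
¬2∣n⇒n≡1+[n/2]*2 n 2∤n with n % 2 | m%n<n n 2 | m≡m%n+[m/n]*n n 2 | m%n≡0⇒n∣m n 2
... | 0           | _                     | _        | 2∣n = contradiction (2∣n ≡.refl) 2∤n
... | 1           | _                     | n≡1+n/2*2 | _  = n≡1+n/2*2
... | suc (suc _) | ℕ.s≤s (ℕ.s≤s ())      | _        | _

module CommutativeRingProperties {c ℓ} (R : CommutativeRing c ℓ) where
  open CommutativeRing R
  open import Algebra.Properties.Semiring.Mult semiring using (×-assoc-*; ×1-homo-*; ×-congʳ) renaming (_×_ to _·_)
  open import Algebra.Properties.Semiring.Exp semiring using (_^_; ^-homo-*; ^-assocʳ; ^-congˡ; ^-congʳ)
  open import Algebra.Properties.CommutativeMonoid.Sum +-commutativeMonoid using (sum; sum-init-last; sum-cong-≋; sum-replicate-zero)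
  import Algebra.Properties.CommutativeSemiring.Binomial commutativeSemiring as Binomial
  open IntegerCoefficientSolver R
  open import Relation.Binary.Reasoning.Setoid setoid

  ^[q+2]+^[2q+1]≈norm*trace : ∀ q y → y ^ (q ℕ.+ 2) + y ^ (2 ℕ.* q ℕ.+ 1) ≈ (y * y ^ q) * (y + y ^ q)
  ^[q+2]+^[2q+1]≈norm*trace q y = begin
    y ^ (q ℕ.+ 2) + y ^ ((q ℕ.+ (q ℕ.+ 0)) ℕ.+ 1)  ≈⟨ +-cong (^-homo-* y q 2) (^-homo-* y (q ℕ.+ (q ℕ.+ 0)) 1) ⟩
    Y * y ^ 2 + y ^ (q ℕ.+ (q ℕ.+ 0)) * y ^ 1        ≈⟨ +-congˡ (*-congʳ (^-homo-* y q (q ℕ.+ 0))) ⟩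
    Y * y ^ 2 + Y * y ^ (q ℕ.+ 0) * y ^ 1            ≈⟨ +-congˡ (*-congʳ (*-congˡ (^-congʳ y (ℕ.+-identityʳ q)))) ⟩
    Y * y ^ 2 + Y * Y * y ^ 1                        ≈⟨ solve 2 (λ y Y → Y :* (y :* (y :* con (+ 1))) :+ Y :* Y :* (y :* con (+ 1))
                                                                  := (y :* Y) :* (y :+ Y)) refl y Y ⟩
    (y * Y) * (y + Y)                                ∎
    where
    Y : Carrier
    Y = y ^ q

  ×1-homo-^ : ∀ m n → (m ℕ.^ n) · 1# ≈ (m · 1#) ^ n
  ×1-homo-^ m zero    = +-identityʳ 1#
  ×1-homo-^ m (suc n) = trans (×1-homo-* m (m ℕ.^ n)) (*-congˡ (×1-homo-^ m n))

  p·1≈0⇒p∣m⇒m·x≈0 : ∀ {p m} → p · 1# ≈ 0# → p ∣ m → ∀ x → m · x ≈ 0#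
  p·1≈0⇒p∣m⇒m·x≈0 {p} {m} p·1≈0 (divides t m≡t*p) x = begin
    m · x              ≈⟨ ×-congʳ m (*-identityˡ x) ⟨
    m · (1# * x)       ≈⟨ ×-assoc-* m 1# x ⟨
    m · 1# * x         ≡⟨ ≡.cong (λ n → n · 1# * x) m≡t*p ⟩
    (t ℕ.* p) · 1# * x ≈⟨ *-congʳ (×1-homo-* t p) ⟩
    t · 1# * p · 1# * x ≈⟨ *-congʳ (*-congˡ p·1≈0) ⟩
    t · 1# * 0# * x    ≈⟨ solve 2 (λ a x → a :* con (+ 0) :* x := con (+ 0)) refl (t · 1#) x ⟩
    0#                 ∎

  ^p-+ : ∀ {p} → Prime p → p · 1# ≈ 0# → ∀ x y → (x + y) ^ p ≈ x ^ p + y ^ p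
  ^p-+ {suc (suc n)} p-prime p·1≈0 x y = begin
    (x + y) ^ p′                                ≈⟨ Binomial.theorem p′ x y ⟩
    T Fin.zero + sum (T ∘ Fin.suc)              ≈⟨ +-congˡ (sum-init-last (T ∘ Fin.suc)) ⟩
    T Fin.zero + (sum (T ∘ inner) + T top)      ≈⟨ +-cong first (+-cong (trans (sum-cong-≋ middle) (sum-replicate-zero (suc n))) last) ⟩
    y ^ p′ + (0# + x ^ p′)                      ≈⟨ solve 2 (λ a b → b :+ (con (+ 0) :+ a) := a :+ b) refl (x ^ p′) (y ^ p′) ⟩
    x ^ p′ + y ^ p′                             ∎
    where
    p′ : ℕ
    p′ = suc (suc n)
    T : Fin (suc p′) → Carrier
    T = Binomial.binomialTerm x y p′
    inner : Fin (suc n) → Fin (suc p′)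
    inner = Fin.suc ∘ Fin.inject₁
    top : Fin (suc p′)
    top = Fin.suc (Fin.fromℕ (suc n))
    first : T Fin.zero ≈ y ^ p′
    first = trans (+-identityʳ _) (*-identityˡ _)
    last : T top ≈ x ^ p′
    last = begin
      (p′ C Fin.toℕ top) · (x ^ Fin.toℕ top * y ^ (p′ ∸ Fin.toℕ top))
        ≡⟨ ≡.cong (λ m → (p′ C m) · (x ^ m * y ^ (p′ ∸ m))) (≡.cong suc (Fin.toℕ-fromℕ (suc n))) ⟩
      (p′ C p′) · (x ^ p′ * y ^ (p′ ∸ p′))
        ≡⟨ ≡.cong₂ (λ m l → m · (x ^ p′ * y ^ l)) (nCn≡1 p′) (ℕ.n∸n≡0 p′) ⟩
      1 · (x ^ p′ * 1#)
        ≈⟨ trans (+-identityʳ _) (*-identityʳ _) ⟩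
      x ^ p′ ∎
    middle : ∀ j → T (inner j) ≈ 0#
    middle j = p·1≈0⇒p∣m⇒m·x≈0 p·1≈0 (p∣pCk _ p-prime (ℕ.s≤s ℕ.z≤n) (ℕ.s≤s (Fin.inject₁ℕ< j))) _

  ^[p^j]-+ : ∀ {p} → Prime p → p · 1# ≈ 0# → ∀ j x y → (x + y) ^ (p ℕ.^ j) ≈ x ^ (p ℕ.^ j) + y ^ (p ℕ.^ j)
  ^[p^j]-+         p-prime p·1≈0 zero    x y = distribʳ 1# x y
  ^[p^j]-+ {p = p} p-prime p·1≈0 (suc j) x y = begin
    (x + y) ^ (p ℕ.* p ℕ.^ j)                  ≈⟨ ^-assocʳ (x + y) p (p ℕ.^ j) ⟨
    ((x + y) ^ p) ^ (p ℕ.^ j)                  ≈⟨ ^-congˡ (p ℕ.^ j) (^p-+ p-prime p·1≈0 x y) ⟩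
    (x ^ p + y ^ p) ^ (p ℕ.^ j)                ≈⟨ ^[p^j]-+ p-prime p·1≈0 j (x ^ p) (y ^ p) ⟩
    (x ^ p) ^ (p ℕ.^ j) + (y ^ p) ^ (p ℕ.^ j)  ≈⟨ +-cong (^-assocʳ x p (p ℕ.^ j)) (^-assocʳ y p (p ℕ.^ j)) ⟩
    x ^ (p ℕ.* p ℕ.^ j) + y ^ (p ℕ.* p ℕ.^ j)  ∎

  1+1≉0 : ∀ {p} → ¬ 2 ∣ p → p · 1# ≈ 0# → ¬ 1# ≈ 0# → ¬ 1# + 1# ≈ 0#
  1+1≉0 {p} 2∤p p·1≈0 1≉0 2≈0 = 1≉0 (begin
    1#                          ≈⟨ solve 1 (λ a → con (+ 1) := con (+ 1) :+ a :* con (+ 0)) refl ((p / 2) · 1#) ⟩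
    1# + (p / 2) · 1# * 0#      ≈⟨ +-congˡ (*-congˡ (trans (+-congˡ (+-identityʳ 1#)) 2≈0)) ⟨
    1# + (p / 2) · 1# * 2 · 1#  ≈⟨ +-congˡ (×1-homo-* (p / 2) 2) ⟨
    suc (p / 2 ℕ.* 2) · 1#      ≡⟨ ≡.cong (_· 1#) (¬2∣n⇒n≡1+[n/2]*2 p 2∤p) ⟨
    p · 1#                      ≈⟨ p·1≈0 ⟩
    0#                          ∎)

module _ {c ℓ} (F : CommutativeRing c ℓ) where
  open CommutativeRing F

  module Field (1≉0 : ¬ 1# ≈ 0#) (inverse : ∀ x → ¬ x ≈ 0# → ∃ λ y → x * y ≈ 1#) where
    open import Algebra.Properties.Ring ring using (x+x≈x⇒x≈0; +-inverseˡ-unique; +-cancelˡ; x∙y⁻¹≈ε⇒x≈y; -‿involutive)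
    open import Algebra.Properties.Semiring.Exp semiring using (_^_)
    open IntegerCoefficientSolver F
    open import Relation.Binary.Reasoning.Setoid setoid

    inv : ∀ x → ¬ x ≈ 0# → Carrier
    inv x x≉0 = proj₁ (inverse x x≉0)

    x*inv≈1 : ∀ x (x≉0 : ¬ x ≈ 0#) → x * inv x x≉0 ≈ 1#
    x*inv≈1 x x≉0 = proj₂ (inverse x x≉0)

    invertible⇒≉0 : ∀ {x y} → x * y ≈ 1# → ¬ x ≈ 0#
    invertible⇒≉0 {x} {y} xy≈1 x≈0 = 1≉0 (begin
      1#      ≈⟨ xy≈1 ⟨
      x * y   ≈⟨ *-congʳ x≈0 ⟩
      0# * y  ≈⟨ zeroˡ y ⟩
      0#      ∎)

    *-cancelˡ : ∀ {x y z} → ¬ x ≈ 0# → x * y ≈ x * z → y ≈ z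
    *-cancelˡ {x} {y} {z} x≉0 xy≈xz = begin
      y                ≈⟨ inv*[x*y]≈y y ⟨
      x⁻¹ * (x * y)    ≈⟨ *-congˡ xy≈xz ⟩
      x⁻¹ * (x * z)    ≈⟨ inv*[x*y]≈y z ⟩
      z                ∎
      where
      x⁻¹ : Carrier
      x⁻¹ = inv x x≉0
      inv*[x*y]≈y : ∀ y → x⁻¹ * (x * y) ≈ y
      inv*[x*y]≈y y = begin
        x⁻¹ * (x * y)  ≈⟨ solve 3 (λ a b y → b :* (a :* y) := (a :* b) :* y) refl x x⁻¹ y ⟩
        (x * x⁻¹) * y  ≈⟨ *-congʳ (x*inv≈1 x x≉0) ⟩
        1# * y         ≈⟨ *-identityˡ y ⟩
        y              ∎

    *-≉0 : ∀ {x y} → ¬ x ≈ 0# → ¬ y ≈ 0# → ¬ x * y ≈ 0#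
    *-≉0 {x} x≉0 y≉0 xy≈0 = y≉0 (*-cancelˡ x≉0 (trans xy≈0 (sym (zeroʳ x))))

    ^-≉0 : ∀ {x} n → ¬ x ≈ 0# → ¬ x ^ n ≈ 0#
    ^-≉0 zero    x≉0 = 1≉0
    ^-≉0 (suc n) x≉0 = *-≉0 x≉0 (^-≉0 n x≉0)

    inverse-unique : ∀ {x y z} → x * y ≈ 1# → x * z ≈ 1# → y ≈ z
    inverse-unique xy≈1 xz≈1 = *-cancelˡ (invertible⇒≉0 xy≈1) (trans xy≈1 (sym xz≈1))

    module Involution (σ : Carrier → Carrier) (σ-cong : ∀ {x y} → x ≈ y → σ x ≈ σ y)
                      (σ-+ : ∀ x y → σ (x + y) ≈ σ x + σ y) (σ-* : ∀ x y → σ (x * y) ≈ σ x * σ y)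
                      (σ-involutive : ∀ x → σ (σ x) ≈ x) (1+1≉0 : ¬ 1# + 1# ≈ 0#) where

      Fixed Skew : Carrier → Set ℓ
      Fixed x = σ x ≈ x
      Skew  x = σ x ≈ - x

      norm tr Δ : Carrier → Carrier
      norm x = x * σ x
      tr   x = x + σ x
      Δ    x = σ x - x

      σ-0 : σ 0# ≈ 0#
      σ-0 = x+x≈x⇒x≈0 (σ 0#) (trans (sym (σ-+ 0# 0#)) (σ-cong (+-identityʳ 0#)))

      σ-1 : σ 1# ≈ 1#
      σ-1 = begin
        σ 1#             ≈⟨ *-identityʳ (σ 1#) ⟨
        σ 1# * 1#        ≈⟨ *-congˡ (σ-involutive 1#) ⟨
        σ 1# * σ (σ 1#)  ≈⟨ σ-* 1# (σ 1#) ⟨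
        σ (1# * σ 1#)    ≈⟨ σ-cong (*-identityˡ (σ 1#)) ⟩
        σ (σ 1#)         ≈⟨ σ-involutive 1# ⟩
        1#               ∎

      σ-‿ : ∀ x → σ (- x) ≈ - σ x
      σ-‿ x = +-inverseˡ-unique (σ (- x)) (σ x) (trans (sym (σ-+ (- x) x)) (trans (σ-cong (-‿inverseˡ x)) σ-0))

      σ[x-y]≈σx-σy : ∀ x y → σ (x - y) ≈ σ x - σ y
      σ[x-y]≈σx-σy x y = trans (σ-+ x (- y)) (+-congˡ (σ-‿ y))

      norm-cong : ∀ {x y} → x ≈ y → norm x ≈ norm y
      norm-cong x≈y = *-cong x≈y (σ-cong x≈y)

      Δ-cong : ∀ {x y} → x ≈ y → Δ x ≈ Δ y
      Δ-cong x≈y = +-cong (σ-cong x≈y) (-‿cong x≈y)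

      Δ-+ : ∀ x y → Δ (x + y) ≈ Δ x + Δ y
      Δ-+ x y = trans (+-congʳ (σ-+ x y)) (solve 4 (λ a b x y → (a :+ b) :- (x :+ y) := (a :- x) :+ (b :- y)) refl (σ x) (σ y) x y)

      Δ≈0⇒fixed : ∀ {x} → Δ x ≈ 0# → Fixed x
      Δ≈0⇒fixed {x} = x∙y⁻¹≈ε⇒x≈y (σ x) x

      fixed*fixed : ∀ {x y} → Fixed x → Fixed y → Fixed (x * y)
      fixed*fixed {x} {y} σx≈x σy≈y = trans (σ-* x y) (*-cong σx≈x σy≈y)

      skew*fixed : ∀ {x y} → Skew x → Fixed y → Skew (x * y)
      skew*fixed {x} {y} σx≈-x σy≈y = begin
        σ (x * y)   ≈⟨ σ-* x y ⟩
        σ x * σ y   ≈⟨ *-cong σx≈-x σy≈y ⟩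
        - x * y     ≈⟨ solve 2 (λ x y → :- x :* y := :- (x :* y)) refl x y ⟩
        - (x * y)   ∎

      skew*skew : ∀ {x y} → Skew x → Skew y → Fixed (x * y)
      skew*skew {x} {y} σx≈-x σy≈-y = begin
        σ (x * y)   ≈⟨ σ-* x y ⟩
        σ x * σ y   ≈⟨ *-cong σx≈-x σy≈-y ⟩
        - x * - y   ≈⟨ solve 2 (λ x y → :- x :* :- y := x :* y) refl x y ⟩
        x * y       ∎

      skew-difference : ∀ {x y} → Skew x → Skew y → Skew (x - y)
      skew-difference {x} {y} σx≈-x σy≈-y = begin
        σ (x - y)   ≈⟨ σ[x-y]≈σx-σy x y ⟩
        σ x - σ y   ≈⟨ +-cong σx≈-x (-‿cong σy≈-y) ⟩
        - x - - y   ≈⟨ solve 2 (λ x y → :- x :- :- y := :- (x :- y)) refl x y ⟩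
        - (x - y)   ∎

      fixed-norm : ∀ x → Fixed (norm x)
      fixed-norm x = trans (σ-* x (σ x)) (trans (*-congˡ (σ-involutive x)) (*-comm (σ x) x))

      fixed-tr : ∀ x → Fixed (tr x)
      fixed-tr x = trans (σ-+ x (σ x)) (trans (+-congˡ (σ-involutive x)) (+-comm (σ x) x))

      skew-Δ : ∀ x → Skew (Δ x)
      skew-Δ x = begin
        σ (σ x - x)    ≈⟨ σ[x-y]≈σx-σy (σ x) x ⟩
        σ (σ x) - σ x  ≈⟨ +-congʳ (σ-involutive x) ⟩
        x - σ x        ≈⟨ solve 2 (λ x y → x :- y := :- (y :- x)) refl x (σ x) ⟩
        - (σ x - x)    ∎

      σ-inverse : ∀ {x y} → x * y ≈ 1# → σ x * σ y ≈ 1#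
      σ-inverse {x} {y} xy≈1 = trans (sym (σ-* x y)) (trans (σ-cong xy≈1) σ-1)

      fixed-inverse : ∀ {x y} → Fixed x → x * y ≈ 1# → Fixed y
      fixed-inverse {x} {y} σx≈x xy≈1 = inverse-unique (trans (*-congʳ (sym σx≈x)) (σ-inverse xy≈1)) xy≈1

      skew-inverse : ∀ {x y} → Skew x → x * y ≈ 1# → Skew y
      skew-inverse {x} {y} σx≈-x xy≈1 = begin
        σ y        ≈⟨ -‿involutive (σ y) ⟨
        - - σ y    ≈⟨ -‿cong (inverse-unique x*-σy≈1 xy≈1) ⟩
        - y        ∎
        where
        x*-σy≈1 : x * - σ y ≈ 1#
        x*-σy≈1 = begin
          x * - σ y    ≈⟨ solve 2 (λ x y → x :* :- y := :- x :* y) refl x (σ y) ⟩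
          - x * σ y    ≈⟨ *-congʳ σx≈-x ⟨
          σ x * σ y    ≈⟨ σ-inverse xy≈1 ⟩
          1#           ∎

      ½ : Carrier
      ½ = inv (1# + 1#) 1+1≉0

      fixed-½ : Fixed ½
      fixed-½ = fixed-inverse (trans (σ-+ 1# 1#) (+-cong σ-1 σ-1)) (x*inv≈1 (1# + 1#) 1+1≉0)

      x*½+x*½≈x : ∀ x → x * ½ + x * ½ ≈ x
      x*½+x*½≈x x = begin
        x * ½ + x * ½       ≈⟨ solve 2 (λ x h → x :* h :+ x :* h := x :* ((con (+ 1) :+ con (+ 1)) :* h)) refl x ½ ⟩
        x * ((1# + 1#) * ½) ≈⟨ *-congˡ (x*inv≈1 (1# + 1#) 1+1≉0) ⟩
        x * 1#              ≈⟨ *-identityʳ x ⟩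
        x                   ∎

      tr[Δx+y]≈tr[y] : ∀ x y → tr (Δ x + y) ≈ tr y
      tr[Δx+y]≈tr[y] x y = begin
        (Δ x + y) + σ (Δ x + y)      ≈⟨ +-congˡ (trans (σ-+ (Δ x) y) (+-congʳ (skew-Δ x))) ⟩
        (Δ x + y) + (- Δ x + σ y)    ≈⟨ solve 3 (λ d y z → (d :+ y) :+ (:- d :+ z) := y :+ z) refl (Δ x) y (σ y) ⟩
        y + σ y                      ∎

      Δ-onto-skew : ∀ {a} → ¬ Fixed a → ∀ {v} → Skew v → ∃ λ x → Δ x ≈ v
      Δ-onto-skew {a} a-unfixed {v} v-skew = μ * a , (begin
        σ (μ * a) - μ * a      ≈⟨ +-congʳ (trans (σ-* μ a) (*-congʳ μ-fixed)) ⟩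
        μ * σ a - μ * a        ≈⟨ solve 4 (λ v e b a → v :* e :* b :- v :* e :* a := v :* ((b :- a) :* e)) refl v e⁻¹ (σ a) a ⟩
        v * (Δ a * e⁻¹)        ≈⟨ *-congˡ (x*inv≈1 (Δ a) Δa≉0) ⟩
        v * 1#                 ≈⟨ *-identityʳ v ⟩
        v                      ∎)
        where
        Δa≉0 : ¬ Δ a ≈ 0#
        Δa≉0 = a-unfixed ∘ Δ≈0⇒fixed
        e⁻¹ μ : Carrier
        e⁻¹ = inv (Δ a) Δa≉0
        μ = v * e⁻¹
        μ-fixed : Fixed μ
        μ-fixed = skew*skew v-skew (skew-inverse (skew-Δ a) (x*inv≈1 (Δ a) Δa≉0))

      Δ[Δx+y]-onto-skew : ∀ {a} → ¬ Fixed a → ∀ y {r} → Skew r → ∃ λ x → Δ (Δ x + y) ≈ r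
      Δ[Δx+y]-onto-skew a-unfixed y {r} r-skew = x , (begin
        Δ (Δ x + y)                      ≈⟨ Δ-+ (Δ x) y ⟩
        (σ (Δ x) - Δ x) + Δ y            ≈⟨ +-congʳ (+-congʳ (skew-Δ x)) ⟩
        (- Δ x - Δ x) + Δ y              ≈⟨ solve 2 (λ d e → (:- d :- d) :+ e := e :- (d :+ d)) refl (Δ x) (Δ y) ⟩
        Δ y - (Δ x + Δ x)                ≈⟨ +-congˡ (-‿cong (trans (+-cong Δx≈d½ Δx≈d½) (x*½+x*½≈x d))) ⟩
        Δ y - (Δ y - r)                  ≈⟨ solve 2 (λ e r → e :- (e :- r) := r) refl (Δ y) r ⟩
        r                                ∎)
        where
        d : Carrier
        d = Δ y - r
        preimage : ∃ λ x → Δ x ≈ d * ½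
        preimage = Δ-onto-skew a-unfixed (skew*fixed (skew-difference (skew-Δ y) r-skew) fixed-½)
        x : Carrier
        x = proj₁ preimage
        Δx≈d½ : Δ x ≈ d * ½
        Δx≈d½ = proj₂ preimage

      norm-+-skew : ∀ w {s} → Skew s → norm (w + s) ≈ norm w + s * (Δ w - s)
      norm-+-skew w {s} σs≈-s = begin
        (w + s) * σ (w + s)       ≈⟨ *-congˡ (trans (σ-+ w s) (+-congˡ σs≈-s)) ⟩
        (w + s) * (σ w + - s)     ≈⟨ solve 3 (λ w v s → (w :+ s) :* (v :+ :- s) := w :* v :+ s :* ((v :- w) :- s)) refl w (σ w) s ⟩
        w * σ w + s * (Δ w - s)   ∎

      module NormTraceMap (γ δ : Carrier) where

        φ : Carrier → Carrier
        φ x = norm (Δ x + δ) * tr δ + γ * x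

        φ-cong : ∀ {x y} → x ≈ y → φ x ≈ φ y
        φ-cong x≈y = +-cong (*-congʳ (norm-cong (+-congʳ (Δ-cong x≈y)))) (*-congˡ x≈y)

        φ-shift : ∀ x t → φ (x + t) ≈ φ x + (Δ t * (Δ (Δ x + δ) - Δ t) * tr δ + γ * t)
        φ-shift x t = begin
          norm (Δ (x + t) + δ) * T + γ * (x + t)      ≈⟨ +-congʳ (*-congʳ (norm-cong Δ[x+t]+δ≈w+s)) ⟩
          norm (w + s) * T + γ * (x + t)              ≈⟨ +-congʳ (*-congʳ (norm-+-skew w (skew-Δ t))) ⟩
          (norm w + s * (Δ w - s)) * T + γ * (x + t)  ≈⟨ solve 6 (λ n m T γ x t → (n :+ m) :* T :+ γ :* (x :+ t) := (n :* T :+ γ :* x) :+ (m :* T :+ γ :* t)) refl (norm w) (s * (Δ w - s)) T γ x t ⟩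
          φ x + (s * (Δ w - s) * T + γ * t)           ∎
          where
          T w s : Carrier
          T = tr δ
          w = Δ x + δ
          s = Δ t
          Δ[x+t]+δ≈w+s : Δ (x + t) + δ ≈ w + s
          Δ[x+t]+δ≈w+s = trans (+-congʳ (Δ-+ x t)) (solve 3 (λ a b d → (a :+ b) :+ d := (a :+ d) :+ b) refl (Δ x) s δ)

        φ-injective-tr≈0 : tr δ ≈ 0# → ¬ γ ≈ 0# → Injective _≈_ _≈_ φ
        φ-injective-tr≈0 trδ≈0 γ≉0 {x} {z} φx≈φz = *-cancelˡ γ≉0 (trans (sym (φ≈γ* x)) (trans φx≈φz (φ≈γ* z)))
          where
          φ≈γ* : ∀ x → φ x ≈ γ * x
          φ≈γ* x = trans (+-congʳ (trans (*-congˡ trδ≈0) (zeroʳ _))) (+-identityˡ _)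

        φ-injective-fixed : Fixed γ → ¬ γ ≈ 0# → Injective _≈_ _≈_ φ
        φ-injective-fixed γ-fixed γ≉0 {x} {z} φx≈φz = *-cancelˡ γ≉0 (begin
          γ * x              ≈⟨ γ*≈φ-ν x ⟩
          φ x - ν x          ≈⟨ +-cong φx≈φz (-‿cong (*-congʳ (norm-cong (+-congʳ Δx≈Δz)))) ⟩
          φ z - ν z          ≈⟨ γ*≈φ-ν z ⟨
          γ * z              ∎)
          where
          ν : Carrier → Carrier
          ν x = norm (Δ x + δ) * tr δ
          γ*≈φ-ν : ∀ x → γ * x ≈ φ x - ν x
          γ*≈φ-ν x = solve 2 (λ n g → g := (n :+ g) :- n) refl (ν x) (γ * x)
          Δφ≈γΔ : ∀ x → Δ (φ x) ≈ γ * Δ x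
          Δφ≈γΔ x = begin
            σ (ν x + γ * x) - φ x               ≈⟨ +-congʳ (σ-+ (ν x) (γ * x)) ⟩
            σ (ν x) + σ (γ * x) - φ x           ≈⟨ +-congʳ (+-cong (fixed*fixed (fixed-norm _) (fixed-tr δ)) (trans (σ-* γ x) (*-congʳ γ-fixed))) ⟩
            ν x + γ * σ x - (ν x + γ * x)       ≈⟨ solve 4 (λ n g a x → n :+ g :* a :- (n :+ g :* x) := g :* (a :- x)) refl (ν x) γ (σ x) x ⟩
            γ * Δ x                             ∎
          Δx≈Δz : Δ x ≈ Δ z
          Δx≈Δz = *-cancelˡ γ≉0 (trans (sym (Δφ≈γΔ x)) (trans (Δ-cong φx≈φz) (Δφ≈γΔ z)))

        collision : ¬ Fixed γ → ¬ tr δ ≈ 0# → ∃₂ λ x t → φ (x + t) ≈ φ x × ¬ t ≈ 0#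
        collision γ-unfixed trδ≉0 = x , t , φ[x+t]≈φ[x] , invertible⇒≉0 t*γ≈1
          where
          γ≉0 : ¬ γ ≈ 0#
          γ≉0 γ≈0 = γ-unfixed (trans (σ-cong γ≈0) (trans σ-0 (sym γ≈0)))
          t s : Carrier
          t = inv γ γ≉0
          s = Δ t
          t*γ≈1 : t * γ ≈ 1#
          t*γ≈1 = trans (*-comm t γ) (x*inv≈1 γ γ≉0)
          sT≉0 : ¬ s * tr δ ≈ 0#
          sT≉0 = *-≉0 (λ s≈0 → γ-unfixed (fixed-inverse (Δ≈0⇒fixed s≈0) t*γ≈1)) trδ≉0
          u : Carrier
          u = inv (s * tr δ) sT≉0
          u-skew : Skew u
          u-skew = skew-inverse (skew*fixed (skew-Δ t) (fixed-tr δ)) (x*inv≈1 (s * tr δ) sT≉0)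
          preimage : ∃ λ x → Δ (Δ x + δ) ≈ s - u
          preimage = Δ[Δx+y]-onto-skew γ-unfixed δ (skew-difference (skew-Δ t) u-skew)
          x : Carrier
          x = proj₁ preimage
          φ[x+t]≈φ[x] : φ (x + t) ≈ φ x
          φ[x+t]≈φ[x] = begin
            φ (x + t)                                     ≈⟨ φ-shift x t ⟩
            φ x + (s * (Δ (Δ x + δ) - s) * tr δ + γ * t)  ≈⟨ +-congˡ (+-cong (*-congʳ (*-congˡ (+-congʳ (proj₂ preimage))))
                                                                             (x*inv≈1 γ γ≉0)) ⟩
            φ x + (s * ((s - u) - s) * tr δ + 1#)         ≈⟨ +-congˡ (solve 4 (λ s T u o → s :* ((s :- u) :- s) :* T :+ o
                                                                                   := o :- s :* T :* u) refl s (tr δ) u 1#) ⟩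
            φ x + (1# - s * tr δ * u)                     ≈⟨ +-congˡ (+-congˡ (-‿cong (x*inv≈1 (s * tr δ) sT≉0))) ⟩
            φ x + (1# - 1#)                               ≈⟨ +-congˡ (-‿inverseʳ 1#) ⟩
            φ x + 0#                                      ≈⟨ +-identityʳ (φ x) ⟩
            φ x                                           ∎

        φ-not-injective : ¬ Fixed γ → ¬ tr δ ≈ 0# → ¬ Injective _≈_ _≈_ φ
        φ-not-injective γ-unfixed trδ≉0 φ-injective = refute (collision γ-unfixed trδ≉0)
          where
          refute : (∃₂ λ x t → φ (x + t) ≈ φ x × ¬ t ≈ 0#) → ⊥
          refute (x , t , φ[x+t]≈φ[x] , t≉0) = t≉0 (+-cancelˡ x t 0# (trans (φ-injective φ[x+t]≈φ[x]) (sym (+-identityʳ x))))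

Fin-injective⇒surjective : ∀ {n} (π : Fin n → Fin n) → Injective _≡_ _≡_ π → Surjective _≡_ _≡_ π
Fin-injective⇒surjective {suc m} π π-injective y with Fin.any? (λ i → π i Fin.≟ y)
... | yes (i , πi≡y) = i , λ { ≡.refl → πi≡y }
... | no  y∉image    = ⊥-elim (Fin.<⇒notInjective (ℕ.n<1+n m) punchOut∘π-injective)
  where
  π≢y : ∀ i → y ≢ π i
  π≢y i y≡πi = y∉image (i , ≡.sym y≡πi)
  punchOut∘π-injective : Injective _≡_ _≡_ (λ i → Fin.punchOut (π≢y i))
  punchOut∘π-injective {i} {j} eq = π-injective (Fin.punchOut-injective (π≢y i) (π≢y j) eq)

module FiniteField {c ℓ} (F : CommutativeRing c ℓ) {N : ℕ} (F-finite : IsFiniteFieldOfSize F N) where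
  open CommutativeRing F
  open IsFiniteFieldOfSize F-finite
  open Field F nontrivial inverses public
  open import Algebra.Properties.Ring ring using (+-identityʳ-unique)
  open import Algebra.Properties.Semiring.Mult semiring using () renaming (_×_ to _·_)
  open import Algebra.Properties.Semiring.Exp semiring using (_^_)
  open CommutativeRingProperties F using (×1-homo-^)
  open IntegerCoefficientSolver F
  module Additive       = CommutativeMonoidSum +-commutativeMonoid
  module Multiplicative = CommutativeMonoidSum *-commutativeMonoid
  open import Relation.Binary.Reasoning.Setoid setoid

  M : ℕ
  M = ℕ.pred N

  N≡1+M : N ≡ suc M
  N≡1+M = nonempty (Inverse.from enumeration 0#)
    where
    nonempty : ∀ {n} → Fin n → n ≡ suc (ℕ.pred n)
    nonempty {suc n} _ = ≡.refl

  -- Indexing by Fin (suc M) allows removing the index of 0# from a permutation.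
  private
    module E = Inverse (≡.subst (λ n → Inverse (≡.setoid (Fin n)) setoid) N≡1+M enumeration)

    from-injective : ∀ {x y} → E.from x ≡ E.from y → x ≈ y
    from-injective {x} {y} eq = trans (sym (E.strictlyInverseˡ x)) (trans (E.to-cong eq) (E.strictlyInverseˡ y))

    permutationOf : (h h⁻¹ : Carrier → Carrier) → (∀ {x y} → x ≈ y → h x ≈ h y) → (∀ {x y} → x ≈ y → h⁻¹ x ≈ h⁻¹ y) →
                    (∀ x → h (h⁻¹ x) ≈ x) → (∀ x → h⁻¹ (h x) ≈ x) → Permutation′ (suc M)
    permutationOf h h⁻¹ h-cong h⁻¹-cong inverseˡ inverseʳ = permutation
      (λ i → E.from (h (E.to i))) (λ i → E.from (h⁻¹ (E.to i)))
      (λ i → ≡.trans (E.from-cong (trans (h-cong (E.strictlyInverseˡ _)) (inverseˡ _))) (E.strictlyInverseʳ i))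
      (λ i → ≡.trans (E.from-cong (trans (h⁻¹-cong (E.strictlyInverseˡ _)) (inverseʳ _))) (E.strictlyInverseʳ i))

  infix 4 _≟_
  _≟_ : Decidable _≈_
  x ≟ y = Dec.map′ from-injective E.from-cong (E.from x Fin.≟ E.from y)

  injective⇒surjective : ∀ {f} → (∀ {x y} → x ≈ y → f x ≈ f y) → Injective _≈_ _≈_ f → Surjective _≈_ _≈_ f
  injective⇒surjective {f} f-cong f-injective y = E.to i , λ {z} z≈x → begin
    f z              ≈⟨ f-cong z≈x ⟩
    f (E.to i)       ≈⟨ E.strictlyInverseˡ _ ⟨
    E.to (π i)       ≡⟨ ≡.cong E.to πi≡y ⟩
    E.to (E.from y)  ≈⟨ E.strictlyInverseˡ y ⟩
    y                ∎
    where
    π : Fin (suc M) → Fin (suc M)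
    π i = E.from (f (E.to i))
    π-injective : Injective _≡_ _≡_ π
    π-injective {i} {j} πi≡πj = ≡.trans (≡.sym (E.strictlyInverseʳ i)) (≡.trans (E.from-cong (f-injective (from-injective πi≡πj))) (E.strictlyInverseʳ j))
    i : Fin (suc M)
    i = proj₁ (Fin-injective⇒surjective π π-injective (E.from y))
    πi≡y : π i ≡ E.from y
    πi≡y = proj₂ (Fin-injective⇒surjective π π-injective (E.from y)) ≡.refl

  -- Translation by 1 permutes the elements, so their sum S satisfies S = S + N · 1.
  N·1≈0 : N · 1# ≈ 0#
  N·1≈0 = ≡.subst (λ n → n · 1# ≈ 0#) (≡.sym N≡1+M) (+-identityʳ-unique S (suc M · 1#) (sym (begin
    S                                             ≈⟨ Additive.∑-permute E.to τ ⟩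
    Additive.sum {suc M} (λ i → E.to (τ ⟨$⟩ʳ i))  ≈⟨ Additive.sum-cong-≋ {suc M} (λ i → E.strictlyInverseˡ (E.to i + 1#)) ⟩
    Additive.sum {suc M} (λ i → E.to i + 1#)      ≈⟨ Additive.∑-distrib-+ E.to (λ _ → 1#) ⟩
    S + Additive.sum {suc M} (λ _ → 1#)           ≈⟨ +-congˡ (Additive.sum-replicate (suc M)) ⟩
    S + suc M · 1#                                ∎)))
    where
    S : Carrier
    S = Additive.sum E.to
    τ : Permutation′ (suc M)
    τ = permutationOf (_+ 1#) (_- 1#) +-congʳ +-congʳ
          (λ x → solve 1 (λ x → (x :- con (+ 1)) :+ con (+ 1) := x) refl x)
          (λ x → solve 1 (λ x → (x :+ con (+ 1)) :- con (+ 1) := x) refl x)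

  ^≈0⇒≈0 : ∀ {x} n → x ^ n ≈ 0# → x ≈ 0#
  ^≈0⇒≈0 {x} n xⁿ≈0 with x ≟ 0#
  ... | yes x≈0 = x≈0
  ... | no  x≉0 = contradiction xⁿ≈0 (^-≉0 n x≉0)

  characteristic : ∀ {p m} → N ≡ p ℕ.^ m → p · 1# ≈ 0#
  characteristic {p} {m} N≡pᵐ = ^≈0⇒≈0 m (begin
    (p · 1#) ^ m     ≈⟨ ×1-homo-^ p m ⟨
    (p ℕ.^ m) · 1#   ≡⟨ ≡.cong (_· 1#) N≡pᵐ ⟨
    N · 1#           ≈⟨ N·1≈0 ⟩
    0#               ∎)

  -- Multiplication by x ≉ 0 permutes the nonzero elements, so their product P satisfies P = xᴹ P.
  x^M≈1 : ∀ {x} → ¬ x ≈ 0# → x ^ M ≈ 1#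
  x^M≈1 {x} x≉0 = *-cancelˡ P≉0 (begin
    P * x ^ M                                         ≈⟨ *-comm P (x ^ M) ⟩
    x ^ M * P                                         ≈⟨ *-congʳ (Multiplicative.sum-replicate M) ⟨
    Multiplicative.sum {M} (λ _ → x) * P              ≈⟨ Multiplicative.∑-distrib-+ (λ _ → x) unit ⟨
    Multiplicative.sum (λ j → x * unit j)             ≈⟨ Multiplicative.sum-cong-≋ {M} (λ j → sym (unit∘ρ j)) ⟩
    Multiplicative.sum (λ j → unit (ρ ⟨$⟩ʳ j))        ≈⟨ Multiplicative.∑-permute unit ρ ⟨
    P                                                 ≈⟨ *-identityʳ P ⟨
    P * 1#                                            ∎)
    where
    zeroIndex : Fin (suc M)
    zeroIndex = E.from 0#
    unit : Fin M → Carrier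
    unit j = E.to (punchIn zeroIndex j)
    P : Carrier
    P = Multiplicative.sum unit
    P≉0 : ¬ P ≈ 0#
    P≉0 = prod-≉0 unit (λ j unitj≈0 → Fin.punchInᵢ≢i zeroIndex j (≡.trans (≡.sym (E.strictlyInverseʳ _)) (E.from-cong unitj≈0)))
      where
      prod-≉0 : ∀ {n} (f : Fin n → Carrier) → (∀ j → ¬ f j ≈ 0#) → ¬ Multiplicative.sum f ≈ 0#
      prod-≉0 {zero}  f f≉0 = nontrivial
      prod-≉0 {suc n} f f≉0 = *-≉0 (f≉0 Fin.zero) (prod-≉0 (f ∘ Fin.suc) (f≉0 ∘ Fin.suc))
    x⁻¹ : Carrier
    x⁻¹ = inv x x≉0
    π : Permutation′ (suc M)
    π = permutationOf (x *_) (x⁻¹ *_) *-congˡ *-congˡ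
          (λ y → trans (sym (*-assoc x x⁻¹ y)) (trans (*-congʳ (x*inv≈1 x x≉0)) (*-identityˡ y)))
          (λ y → trans (sym (*-assoc x⁻¹ x y)) (trans (*-congʳ (trans (*-comm x⁻¹ x) (x*inv≈1 x x≉0))) (*-identityˡ y)))
    ρ : Permutation′ M
    ρ = remove zeroIndex π
    π-fixes-zero : π ⟨$⟩ʳ zeroIndex ≡ zeroIndex
    π-fixes-zero = E.from-cong (trans (*-congˡ (E.strictlyInverseˡ 0#)) (zeroʳ x))
    unit∘ρ : ∀ j → unit (ρ ⟨$⟩ʳ j) ≈ x * unit j
    unit∘ρ j = begin
      E.to (punchIn zeroIndex (ρ ⟨$⟩ʳ j))                       ≡⟨ ≡.cong (λ k → E.to (punchIn k (ρ ⟨$⟩ʳ j))) π-fixes-zero ⟨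
      E.to (punchIn (π ⟨$⟩ʳ zeroIndex) (ρ ⟨$⟩ʳ j))              ≡⟨ ≡.cong E.to (insert-punchIn zeroIndex _ ρ j) ⟨
      E.to (insert zeroIndex (π ⟨$⟩ʳ zeroIndex) ρ ⟨$⟩ʳ punchIn zeroIndex j) ≡⟨ ≡.cong E.to (insert-remove zeroIndex π (punchIn zeroIndex j)) ⟩
      E.to (π ⟨$⟩ʳ punchIn zeroIndex j)                          ≈⟨ E.strictlyInverseˡ _ ⟩
      x * unit j                                                ∎

  x^N≈x : ∀ x → x ^ N ≈ x
  x^N≈x x = trans (reflexive (≡.cong (x ^_) N≡1+M)) (x*x^M≈x (x ≟ 0#))
    where
    x*x^M≈x : Dec (x ≈ 0#) → x * x ^ M ≈ x
    x*x^M≈x (yes x≈0) = trans (*-congʳ x≈0) (trans (zeroˡ _) (sym x≈0))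
    x*x^M≈x (no  x≉0) = trans (*-congˡ (x^M≈1 x≉0)) (*-identityʳ x)

module FrobeniusOfQuadraticExtension {c ℓ} (F : CommutativeRing c ℓ) {p k : ℕ} (p-prime : Prime p) (2∤p : ¬ 2 ∣ p)
                                     (F-finite : IsFiniteFieldOfSize F (p ℕ.^ k ℕ.* p ℕ.^ k)) where
  open CommutativeRing F
  open IsFiniteFieldOfSize F-finite using (nontrivial)
  open FiniteField F F-finite public
  open CommutativeRingProperties F using (^[p^j]-+; 1+1≉0)
  open import Algebra.Properties.Semiring.Exp semiring using (_^_; ^-congˡ; ^-assocʳ)
  open import Algebra.Properties.CommutativeSemiring.Exp commutativeSemiring using (^-distrib-*)
  open import Algebra.Properties.Semiring.Mult semiring using () renaming (_×_ to _·_)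

  private
    q : ℕ
    q = p ℕ.^ k

  p·1≈0 : p · 1# ≈ 0#
  p·1≈0 = characteristic {p} {k ℕ.+ k} (≡.sym (ℕ.^-distribˡ-+-* p k k))

  open Involution (_^ q) (^-congˡ q) (^[p^j]-+ p-prime p·1≈0 k) (λ x y → ^-distrib-* x y q)
                  (λ x → trans (^-assocʳ x q q) (x^N≈x x)) (1+1≉0 2∤p p·1≈0 nontrivial) public

theorem3p4 : ∀ {c ℓ : Level} (q : ℕ) → IsOddPrimePower q →
    (F : CommutativeRing c ℓ) → IsFiniteFieldOfSize F (q *ℕ q) →
    let open FieldOps F in
    (γ δ : Carrier) → ¬ (γ ≈ 0#) →
    (IsPermutation (λ x → (x ^ q − x + δ) ^ (q +ℕ 2) + (x ^ q − x + δ) ^ (2 *ℕ q +ℕ 1) + γ * x)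
      ⇔ ((InSubfield q γ × ¬ (γ ≈ 0#)) ⊎ (¬ (γ ≈ 0#) × ¬ InSubfield q γ × Tr q δ ≈ 0#)))
theorem3p4 q (p , k , p-prime , 2∤p , _ , ≡.refl) F F-finite γ δ γ≉0 = mk⇔ necessary sufficient
  where
  open FieldOps F
  open CommutativeRingProperties F using (^[q+2]+^[2q+1]≈norm*trace)
  open FrobeniusOfQuadraticExtension F {k = k} p-prime 2∤p F-finite
  open NormTraceMap γ δ

  f : Carrier → Carrier
  f x = (x ^ q − x + δ) ^ (q +ℕ 2) + (x ^ q − x + δ) ^ (2 *ℕ q +ℕ 1) + γ * x

  f≈φ : ∀ x → f x ≈ φ x
  f≈φ x = +-congʳ (trans (^[q+2]+^[2q+1]≈norm*trace q (Δ x + δ)) (*-congˡ (tr[Δx+y]≈tr[y] x δ)))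

  permutation-if-φ-injective : Injective _≈_ _≈_ φ → IsPermutation f
  permutation-if-φ-injective φ-injective = f-injective , injective⇒surjective f-cong f-injective
    where
    f-injective : Injective _≈_ _≈_ f
    f-injective {x} {z} fx≈fz = φ-injective (trans (sym (f≈φ x)) (trans fx≈fz (f≈φ z)))
    f-cong : ∀ {x z} → x ≈ z → f x ≈ f z
    f-cong {x} {z} x≈z = trans (f≈φ x) (trans (φ-cong x≈z) (sym (f≈φ z)))

  necessary : IsPermutation f → (InSubfield q γ × ¬ γ ≈ 0#) ⊎ (¬ γ ≈ 0# × ¬ InSubfield q γ × Tr q δ ≈ 0#)
  necessary (f-injective , _) with γ ^ q ≟ γ | Tr q δ ≟ 0#
  ... | yes γ-fixed  | _          = inj₁ (γ-fixed , γ≉0)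
  ... | no γ-unfixed | yes trδ≈0  = inj₂ (γ≉0 , γ-unfixed , trδ≈0)
  ... | no γ-unfixed | no trδ≉0   = contradiction (λ {x} {z} φx≈φz → f-injective (trans (f≈φ x) (trans φx≈φz (sym (f≈φ z)))))
                                                  (φ-not-injective γ-unfixed trδ≉0)

  sufficient : (InSubfield q γ × ¬ γ ≈ 0#) ⊎ (¬ γ ≈ 0# × ¬ InSubfield q γ × Tr q δ ≈ 0#) → IsPermutation f
  sufficient (inj₁ (γ-fixed , _))    = permutation-if-φ-injective (φ-injective-fixed γ-fixed γ≉0)
  sufficient (inj₂ (_ , _ , trδ≈0))  = permutation-if-φ-injective (φ-injective-tr≈0 trδ≈0 γ≉0)
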